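{- Let $\mathbf{A}$ be a Stone distributive nearlattice and $F$ a filter of $A$. Then $\sigma(F)=\{x\in A\colon x^{\top}\veebar F=A\}$ is the greatest $\alpha$-filter contained in $F$; that is, $\sigma(F)$ is an $\alpha$-filter with $\sigma(F)\subseteq F$, and every $\alpha$-filter $G$ with $G\subseteq F$ satisfies $G\subseteq\sigma(F)$.
   Context: A distributive nearlattice is a join-semilattice $\langle A,\vee,1\rangle$ with greatest element $1$ in which every principal filter $[a)=\{x\in A\colon a\le x\}$ is a bounded distributive lattice. A filter of $A$ is a subset containing $1$, upward closed, and closed under those binary meets that exist; for filters $F,G$, $F\veebar G$ is the smallest filter containing $F\cup G$. For $a\in A$, $a^{\top}=\{x\in A\colon x\vee a=1\}$ and $a^{\top\top}=\{y\in A\colon y\vee x=1\text{ for all }x\in a^{\top}\}$. A filter $F$ is an $\alpha$-filter if $a^{\top\top}\subseteq F$ for all $a\in F$. $\mathbf{A}$ is Stone if $a^{\top}\veebar a^{\top\top}=A$ for every $a\in A$. -}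

module Defs where

open import Level using (Level; _⊔_) renaming (suc to lsuc; zero to lzero)
open import Data.Product using (Σ; _×_; _,_)
open import Relation.Binary.PropositionalEquality using (_≡_)
open import Relation.Unary using (Pred; _⊆_; _∈_)

record JoinSemilattice₁ : Set₁ where
  infixr 6 _∨_
  infix 4 _≤_
  field
    Carrier : Set
    _∨_     : Carrier → Carrier → Carrier
    𝟏       : Carrier
    ∨-assoc : ∀ x y z → (x ∨ y) ∨ z ≡ x ∨ (y ∨ z)
    ∨-comm  : ∀ x y → x ∨ y ≡ y ∨ x
    ∨-idem  : ∀ x → x ∨ x ≡ x
    ∨-top   : ∀ x → x ∨ 𝟏 ≡ 𝟏

  _≤_ : Carrier → Carrier → Set
  x ≤ y = x ∨ y ≡ y

  IsMeetIn : Carrier → Carrier → Carrier → Carrier → Set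
  IsMeetIn a x y m =
    a ≤ m × m ≤ x × m ≤ y × (∀ z → a ≤ z → z ≤ x → z ≤ y → z ≤ m)

  IsMeet : Carrier → Carrier → Carrier → Set
  IsMeet x y m = m ≤ x × m ≤ y × (∀ z → z ≤ x → z ≤ y → z ≤ m)

-- Distributive nearlattice: every principal filter [a) (with the induced order)
-- is a bounded distributive lattice.  [a) is bounded by a and 1, and is closed
-- under ∨; we require existence of meets in [a) and distributivity.
record DistributiveNearlattice : Set₁ where
  field
    semilattice : JoinSemilattice₁
  open JoinSemilattice₁ semilattice public
  field
    meetIn : ∀ a x y → a ≤ x → a ≤ y → Σ Carrier (λ m → IsMeetIn a x y m)
    distribIn : ∀ a x y z m₁ m₂ m₃ → a ≤ x → a ≤ y → a ≤ z →
      IsMeetIn a x (y ∨ z) m₁ → IsMeetIn a x y m₂ → IsMeetIn a x z m₃ →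
      m₁ ≡ m₂ ∨ m₃

module NearlatticeNotions (N : DistributiveNearlattice) where
  open DistributiveNearlattice N

  record IsFilter {ℓ : Level} (F : Pred Carrier ℓ) : Set ℓ where
    field
      has-𝟏    : 𝟏 ∈ F
      up-closed : ∀ {x y} → x ≤ y → x ∈ F → y ∈ F
      meet-closed : ∀ {x y m} → IsMeet x y m → x ∈ F → y ∈ F → m ∈ F

  _⊻_ : {ℓ₁ ℓ₂ : Level} → Pred Carrier ℓ₁ → Pred Carrier ℓ₂ →
        Pred Carrier (lsuc lzero ⊔ ℓ₁ ⊔ ℓ₂)
  (F ⊻ G) x = (H : Pred Carrier lzero) → IsFilter H → F ⊆ H → G ⊆ H → x ∈ H

  IsWhole : {ℓ : Level} → Pred Carrier ℓ → Set ℓ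
  IsWhole P = ∀ x → x ∈ P

  _ᵀ : Carrier → Pred Carrier lzero
  (a ᵀ) x = x ∨ a ≡ 𝟏

  _ᵀᵀ : Carrier → Pred Carrier lzero
  (a ᵀᵀ) y = ∀ x → x ∈ (a ᵀ) → y ∨ x ≡ 𝟏

  record IsAlphaFilter {ℓ : Level} (F : Pred Carrier ℓ) : Set ℓ where
    field
      isFilter : IsFilter F
      ᵀᵀ-closed : ∀ {a} → a ∈ F → (a ᵀᵀ) ⊆ F

  IsStone : Set₁
  IsStone = ∀ a → IsWhole ((a ᵀ) ⊻ (a ᵀᵀ))

  σ : {ℓ : Level} → Pred Carrier ℓ → Pred Carrier (lsuc lzero ⊔ ℓ)
  σ F x = IsWhole ((x ᵀ) ⊻ F)

-- Since x ∨ _ maps filters to filters (by distributivity of the principal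
-- filters), σ(F) ⊆ F and σ(F) is closed under meets; α-closedness holds because
-- b ∈ a^⊤⊤ gives a^⊤ ⊆ b^⊤. Maximality is where Stone enters: for x in an
-- α-filter G ⊆ F, x^⊤⊤ ⊆ F, so A = x^⊤ ⊻ x^⊤⊤ ⊆ x^⊤ ⊻ F.
module Submission where

open import Defs
open import Level using (0ℓ)
open import Function using (id; _∘_)
open import Data.Product using (_×_; _,_)
open import Relation.Unary using (Pred; _⊆_; _∈_; _⊢_)
open import Relation.Binary.PropositionalEquality using (_≡_; sym; trans; cong; subst)

module JoinSemilatticeOrder (L : JoinSemilattice₁) where
  open JoinSemilattice₁ L

  ≤-refl : ∀ {x} → x ≤ x
  ≤-refl {x} = ∨-idem x

  ≤-trans : ∀ {x y z} → x ≤ y → y ≤ z → x ≤ z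
  ≤-trans {x} {y} {z} x≤y y≤z =
    trans (cong (x ∨_) (sym y≤z))
      (trans (sym (∨-assoc x y z)) (trans (cong (_∨ z) x≤y) y≤z))

  x≤x∨y : ∀ x y → x ≤ x ∨ y
  x≤x∨y x y = trans (sym (∨-assoc x x y)) (cong (_∨ y) (∨-idem x))

  y≤x∨y : ∀ x y → y ≤ x ∨ y
  y≤x∨y x y = subst (y ≤_) (∨-comm y x) (x≤x∨y y x)

  ∨-least : ∀ {x y z} → x ≤ z → y ≤ z → x ∨ y ≤ z
  ∨-least {x} {y} {z} x≤z y≤z = trans (∨-assoc x y z) (trans (cong (x ∨_) y≤z) x≤z)

  ∨-mono-≤ : ∀ {u v a b} → u ≤ v → a ≤ b → u ∨ a ≤ v ∨ b
  ∨-mono-≤ {u} {v} {a} {b} u≤v a≤b =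
    ∨-least (≤-trans u≤v (x≤x∨y v b)) (≤-trans a≤b (y≤x∨y v b))

  𝟏≤⇒≡𝟏 : ∀ {x} → 𝟏 ≤ x → x ≡ 𝟏
  𝟏≤⇒≡𝟏 {x} 𝟏≤x = trans (sym 𝟏≤x) (trans (∨-comm 𝟏 x) (∨-top x))

  ≡𝟏⇒𝟏≤ : ∀ {x} → x ≡ 𝟏 → 𝟏 ≤ x
  ≡𝟏⇒𝟏≤ x≡𝟏 = subst (𝟏 ≤_) (sym x≡𝟏) (∨-idem 𝟏)

  ∨-≡𝟏-mono : ∀ {u v a b} → u ≤ v → a ≤ b → u ∨ a ≡ 𝟏 → v ∨ b ≡ 𝟏
  ∨-≡𝟏-mono u≤v a≤b u∨a≡𝟏 = 𝟏≤⇒≡𝟏 (subst (_≤ _) u∨a≡𝟏 (∨-mono-≤ u≤v a≤b))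

  ∨-absorbs-below : ∀ a {m z} → m ≤ z → (a ∨ m) ∨ z ≡ a ∨ z
  ∨-absorbs-below a {m} {z} m≤z = trans (∨-assoc a m z) (cong (a ∨_) m≤z)

module DistributiveNearlatticeProperties (N : DistributiveNearlattice) where
  open DistributiveNearlattice N
  open JoinSemilatticeOrder semilattice
  open NearlatticeNotions N

  -- In the distributive lattice [p): c = (c ∧ b) ∨ (c ∧ d) whenever c ≤ b ∨ d.
  ≤-by-distributivity : ∀ {p b c d} → p ≤ b → p ≤ c → p ≤ d → c ≤ b ∨ d →
    (∀ k → IsMeetIn p c d k → k ≤ b) → c ≤ b
  ≤-by-distributivity {p} {b} {c} {d} p≤b p≤c p≤d c≤b∨d c∧d≤b
    with meetIn p c b p≤c p≤b | meetIn p c d p≤c p≤d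
  ... | k₁ , c∧b@(_ , _ , k₁≤b , _) | k₂ , c∧d =
    subst (_≤ b) (sym c≡k₁∨k₂) (∨-least k₁≤b (c∧d≤b k₂ c∧d))
    where
    c-meet : IsMeetIn p c (b ∨ d) c
    c-meet = p≤c , ≤-refl , c≤b∨d , λ _ _ z≤c _ → z≤c

    c≡k₁∨k₂ : c ≡ k₁ ∨ k₂
    c≡k₁∨k₂ = distribIn p c b d c k₁ k₂ p≤c p≤b p≤d c-meet c∧b c∧d

  ∨-distrib-meet : ∀ a {x y m} → IsMeet x y m → IsMeet (a ∨ x) (a ∨ y) (a ∨ m)
  ∨-distrib-meet a {x} {y} {m} (m≤x , m≤y , m-greatest) =
    ∨-mono-≤ ≤-refl m≤x , ∨-mono-≤ ≤-refl m≤y ,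
    λ w w≤a∨x w≤a∨y → ≤-trans (x≤x∨y w m) (w∨m≤a∨m w≤a∨x w≤a∨y)
    where
    m≤a∨m : m ≤ a ∨ m
    m≤a∨m = y≤x∨y a m

    below-shift : ∀ {w z} → m ≤ z → w ≤ a ∨ z → w ∨ m ≤ (a ∨ m) ∨ z
    below-shift {w} {z} m≤z w≤a∨z =
      ∨-least (subst (w ≤_) (sym (∨-absorbs-below a m≤z)) w≤a∨z)
              (≤-trans m≤a∨m (x≤x∨y (a ∨ m) z))

    meet-with-x-below : ∀ {w} → w ≤ a ∨ y → ∀ k → IsMeetIn m (w ∨ m) x k → k ≤ a ∨ m
    meet-with-x-below w≤a∨y k (m≤k , k≤w∨m , k≤x , _) =
      ≤-by-distributivity m≤a∨m m≤k m≤y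
        (≤-trans k≤w∨m (below-shift m≤y w≤a∨y))
        (λ { n (_ , n≤k , n≤y , _) → ≤-trans (m-greatest n (≤-trans n≤k k≤x) n≤y) m≤a∨m })

    w∨m≤a∨m : ∀ {w} → w ≤ a ∨ x → w ≤ a ∨ y → w ∨ m ≤ a ∨ m
    w∨m≤a∨m {w} w≤a∨x w≤a∨y =
      ≤-by-distributivity m≤a∨m (y≤x∨y w m) m≤x (below-shift m≤x w≤a∨x)
        (meet-with-x-below w≤a∨y)

  ∨-preimage-isFilter : ∀ {ℓ} {H : Pred Carrier ℓ} → IsFilter H → ∀ a → IsFilter ((a ∨_) ⊢ H)
  ∨-preimage-isFilter {H = H} H-filter a = record
    { has-𝟏 = subst H (sym (∨-top a)) has-𝟏
    ; up-closed = up-closed ∘ ∨-mono-≤ ≤-refl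
    ; meet-closed = meet-closed ∘ ∨-distrib-meet a
    }
    where open IsFilter H-filter

  ᵀ-mono : ∀ {a b} → a ≤ b → a ᵀ ⊆ b ᵀ
  ᵀ-mono a≤b = ∨-≡𝟏-mono ≤-refl a≤b

  ᵀ-up-closed : ∀ {a u v} → u ≤ v → u ∈ a ᵀ → v ∈ a ᵀ
  ᵀ-up-closed u≤v = ∨-≡𝟏-mono u≤v ≤-refl

  ᵀ-meet-closed : ∀ {x y m u} → IsMeet x y m → u ∈ x ᵀ → u ∈ y ᵀ → u ∈ m ᵀ
  ᵀ-meet-closed {u = u} x∧y u∨x≡𝟏 u∨y≡𝟏 with ∨-distrib-meet u x∧y
  ... | _ , _ , greatest = 𝟏≤⇒≡𝟏 (greatest 𝟏 (≡𝟏⇒𝟏≤ u∨x≡𝟏) (≡𝟏⇒𝟏≤ u∨y≡𝟏))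

  ᵀᵀ⇒ᵀ⊆ᵀ : ∀ {a b} → b ∈ a ᵀᵀ → a ᵀ ⊆ b ᵀ
  ᵀᵀ⇒ᵀ⊆ᵀ {b = b} b∈aᵀᵀ {x} x∈aᵀ = trans (∨-comm x b) (b∈aᵀᵀ x x∈aᵀ)

  ⊻-mono : ∀ {ℓ₁ ℓ₂ ℓ₃ ℓ₄} {P : Pred Carrier ℓ₁} {P′ : Pred Carrier ℓ₂}
    {G : Pred Carrier ℓ₃} {G′ : Pred Carrier ℓ₄} →
    P ⊆ P′ → G ⊆ G′ → (P ⊻ G) ⊆ (P′ ⊻ G′)
  ⊻-mono P⊆P′ G⊆G′ x∈P⊻G H H-filter P′⊆H G′⊆H =
    x∈P⊻G H H-filter (P′⊆H ∘ P⊆P′) (G′⊆H ∘ G⊆G′)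

  ⊻-whole-mono : ∀ {ℓ₁ ℓ₂ ℓ₃ ℓ₄} {P : Pred Carrier ℓ₁} {P′ : Pred Carrier ℓ₂}
    {G : Pred Carrier ℓ₃} {G′ : Pred Carrier ℓ₄} →
    P ⊆ P′ → G ⊆ G′ → IsWhole (P ⊻ G) → IsWhole (P′ ⊻ G′)
  ⊻-whole-mono P⊆P′ G⊆G′ P⊻G-whole z = ⊻-mono P⊆P′ G⊆G′ (P⊻G-whole z)

  -- Apply the wholeness of P ⊻ G at a to the filter (a ∨ _)⁻¹ H, then a ∨ a = a.
  ∈-by-whole-⊻ : ∀ {ℓ₁ ℓ₂} {P : Pred Carrier ℓ₁} {G : Pred Carrier ℓ₂} {H : Pred Carrier 0ℓ} {a} →
    IsWhole (P ⊻ G) → IsFilter H → (∀ {p} → p ∈ P → a ∨ p ∈ H) → G ⊆ H → a ∈ H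
  ∈-by-whole-⊻ {H = H} {a} P⊻G-whole H-filter P⊆a∨⁻¹H G⊆H =
    subst H (∨-idem a)
      (P⊻G-whole a _ (∨-preimage-isFilter H-filter a) P⊆a∨⁻¹H
        (IsFilter.up-closed H-filter (y≤x∨y a _) ∘ G⊆H))

  module _ {ℓ} (F : Pred Carrier ℓ) where

    σ-isFilter : IsFilter (σ F)
    σ-isFilter = record
      { has-𝟏 = λ z H _ 𝟏ᵀ⊆H _ → 𝟏ᵀ⊆H (∨-top z)
      ; up-closed = λ x≤y → ⊻-whole-mono (ᵀ-mono x≤y) id
      ; meet-closed = meet-closed
      }
      where
      meet-closed : ∀ {x y m} → IsMeet x y m → σ F x → σ F y → σ F m
      meet-closed {y = y} x∧y x∈σF y∈σF z H H-filter mᵀ⊆H F⊆H =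
        y∈σF z H H-filter yᵀ⊆H F⊆H
        where
        yᵀ⊆H : y ᵀ ⊆ H
        yᵀ⊆H {w} w∈yᵀ = ∈-by-whole-⊻ x∈σF H-filter
          (λ {u} u∈xᵀ → mᵀ⊆H (ᵀ-meet-closed x∧y
            (ᵀ-up-closed (y≤x∨y w u) u∈xᵀ) (ᵀ-up-closed (x≤x∨y w u) w∈yᵀ)))
          F⊆H

    σ-isAlphaFilter : IsAlphaFilter (σ F)
    σ-isAlphaFilter = record
      { isFilter = σ-isFilter
      ; ᵀᵀ-closed = λ a∈σF b∈aᵀᵀ → ⊻-whole-mono (ᵀᵀ⇒ᵀ⊆ᵀ b∈aᵀᵀ) id a∈σF
      }

    α-filter⊆σ : IsStone → {G : Pred Carrier 0ℓ} → IsAlphaFilter G → G ⊆ F → G ⊆ σ F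
    α-filter⊆σ stone G-α G⊆F {x} x∈G =
      ⊻-whole-mono id (G⊆F ∘ IsAlphaFilter.ᵀᵀ-closed G-α x∈G) (stone x)

  σ⊆ : {F : Pred Carrier 0ℓ} → IsFilter F → σ F ⊆ F
  σ⊆ {F} F-filter {x} x∈σF = ∈-by-whole-⊻ x∈σF F-filter
    (λ {p} p∨x≡𝟏 → subst F (sym (trans (∨-comm x p) p∨x≡𝟏)) (IsFilter.has-𝟏 F-filter))
    id

lemma4p12 : (N : DistributiveNearlattice) →
    let open DistributiveNearlattice N in
    let open NearlatticeNotions N in
    IsStone → (F : Pred Carrier 0ℓ) → IsFilter F →
    IsAlphaFilter (σ F) × σ F ⊆ F ×
    ((G : Pred Carrier 0ℓ) → IsAlphaFilter G → G ⊆ F → G ⊆ σ F)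
lemma4p12 N stone F F-filter =
  σ-isAlphaFilter F , σ⊆ F-filter , λ G → α-filter⊆σ F stone
  where open DistributiveNearlatticeProperties N
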